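{- For every integer $n\ge 2$, $\iota(S_{C_4}^n)=3\cdot 4^{n-2}$.
   Context: $C_4$ is the $4$-cycle. For a graph $G=(V,E)$ and integer $t\ge1$, the generalized Sierpiński graph $S_G^t$ has vertex set $V^t$ (words $u_1\ldots u_t$), and $u=u_1\ldots u_t$, $v=v_1\ldots v_t$ are adjacent iff there is $i\in[t]$ with $u_j=v_j$ for $j<i$, $u_i\ne v_i$ and $u_iv_i\in E$, and $u_j=v_i$, $v_j=u_i$ for all $j>i$. A set $A$ of vertices is isolating if no two vertices outside the closed neighborhood $N[A]$ are adjacent; $\iota$ is the minimum size of an isolating set. -}

module Defs where

open import Data.Nat using (ℕ; zero; suc; _+_; _*_; _^_; _≤_)
open import Data.Fin using (Fin; zero; suc; toℕ; _<_)
open import Data.Vec using (Vec; lookup)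
open import Data.List using (List; length)
open import Data.List.Membership.Propositional using (_∈_)
open import Data.List.Relation.Unary.Unique.Propositional using (Unique)
open import Data.Product using (Σ; ∃; _×_; _,_)
open import Data.Sum using (_⊎_)
open import Relation.Binary.PropositionalEquality using (_≡_)
open import Relation.Nullary using (¬_)

record Graph : Set₁ where
  field
    order : ℕ
    Adj   : Fin order → Fin order → Set

open Graph public

data C4Adj : Fin 4 → Fin 4 → Set where
  e01 : C4Adj zero (suc zero)
  e10 : C4Adj (suc zero) zero
  e12 : C4Adj (suc zero) (suc (suc zero))
  e21 : C4Adj (suc (suc zero)) (suc zero)
  e23 : C4Adj (suc (suc zero)) (suc (suc (suc zero)))
  e32 : C4Adj (suc (suc (suc zero))) (suc (suc zero))
  e30 : C4Adj (suc (suc (suc zero))) zero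
  e03 : C4Adj zero (suc (suc (suc zero)))

C4 : Graph
C4 = record { order = 4 ; Adj = C4Adj }

-- Vertices of the generalized Sierpiński graph S_G^t: words of length t over V(G).
Word : Graph → ℕ → Set
Word G t = Vec (Fin (order G)) t

SAdj : (G : Graph) (t : ℕ) → Word G t → Word G t → Set
SAdj G t u v =
  Σ (Fin t) λ i →
    ((j : Fin t) → j < i → lookup u j ≡ lookup v j)
    × ¬ (lookup u i ≡ lookup v i)
    × Adj G (lookup u i) (lookup v i)
    × ((j : Fin t) → i < j → (lookup u j ≡ lookup v i) × (lookup v j ≡ lookup u i))

InClosedNbhd : (G : Graph) (t : ℕ) → List (Word G t) → Word G t → Set
InClosedNbhd G t A x = ∃ λ a → a ∈ A × (a ≡ x ⊎ SAdj G t a x)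

Isolating : (G : Graph) (t : ℕ) → List (Word G t) → Set
Isolating G t A =
  (x y : Word G t) → ¬ InClosedNbhd G t A x → ¬ InClosedNbhd G t A y → ¬ SAdj G t x y

IsolationNumber : (G : Graph) (t : ℕ) → ℕ → Set
IsolationNumber G t m =
  (Σ (List (Word G t)) λ A → Unique A × Isolating G t A × length A ≡ m)
  × ((A : List (Word G t)) → Unique A → Isolating G t A → m ≤ length A)

-- Write a vertex of S_{C₄}^{m+2} as w · s with w ∈ V^m and s ∈ V².  The 3 · 4^m
-- vertices w · 00, w · 12, w · 32 dominate every vertex whose last letter is 1 or 3;
-- the last letters of adjacent vertices are adjacent in C₄ and {1, 3} is a vertex
-- cover of C₄, so every edge has a dominated end.  Conversely, each copy w · S² holds
-- three "traps", the edges 01–02, 12–21 and 31–32: the closed neighbourhoods of the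
-- ends of a trap lie inside the copy, and those of different traps are disjoint.
-- An isolating set must meet the neighbourhood of each trap, so it has three
-- vertices in each of the 4^m copies.

module Submission where

open import Defs
open import Data.Nat using (ℕ; zero; suc; _+_; _*_; _^_; _∸_; _≤_; z≤n; s≤s; z<s; s<s)
open import Data.Nat.Properties using (*-comm; module ≤-Reasoning)
open import Data.Fin using (Fin; zero; suc)
import Data.Fin.Properties as Fin
open import Data.Vec using (Vec; []; _∷_; lookup; replicate; last)
open import Data.Vec.Properties using (lookup-replicate; ∷-injectiveˡ; ∷-injectiveʳ; ≡-dec)
open import Data.List using (List; []; _∷_; length; map; _++_; cartesianProductWith; allFin)
open import Data.List.Properties using (length-++; length-map; length-tabulate; length-removeAt′)
open import Data.List.Relation.Unary.Any using (here; there; index; _─_; any?)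
open import Data.List.Relation.Unary.All as All using ([]; _∷_)
open import Data.List.Membership.Propositional using (_∈_; find; lose)
open import Data.List.Membership.Propositional.Properties
  using (∈-cartesianProductWith⁺; ∈-cartesianProductWith⁻; ∈-allFin)
open import Data.List.Relation.Binary.Subset.Propositional using (_⊆_)
open import Data.List.Relation.Unary.Unique.Propositional using (Unique)
open import Data.List.Relation.Unary.Unique.Propositional.Properties
  using (cartesianProductWith⁺; allFin⁺)
open import Data.List.Relation.Unary.AllPairs using ([]; _∷_)
open import Data.Product using (∃; ∃₂; _×_; _,_; proj₁; proj₂)
open import Data.Sum using (_⊎_; inj₁; inj₂; [_,_]′; swap)
open import Data.Empty using (⊥-elim)
open import Relation.Nullary using (¬_; yes; no)
open import Relation.Nullary.Decidable using (_×-dec_)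
open import Relation.Unary using (Decidable)
open import Function using (id)
open import Relation.Binary.PropositionalEquality
  using (_≡_; _≢_; refl; sym; trans; cong; cong₂; subst; subst₂; ≢-sym; module ≡-Reasoning)

private variable
  A B C : Set
  k m n : ℕ

length-cartesianProductWith : (f : A → B → C) (xs : List A) (ys : List B) →
  length (cartesianProductWith f xs ys) ≡ length xs * length ys
length-cartesianProductWith f []       ys = refl
length-cartesianProductWith f (x ∷ xs) ys = begin
  length (map (f x) ys ++ cartesianProductWith f xs ys)
    ≡⟨ length-++ (map (f x) ys) ⟩
  length (map (f x) ys) + length (cartesianProductWith f xs ys)
    ≡⟨ cong₂ _+_ (length-map (f x) ys) (length-cartesianProductWith f xs ys) ⟩
  length ys + length xs * length ys ∎
  where open ≡-Reasoning

∈-─⁺ : {x y : A} {ys : List A} (y∈ys : y ∈ ys) → x ∈ ys → x ≢ y → x ∈ (ys ─ y∈ys)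
∈-─⁺ (here refl) (here refl) x≢y = ⊥-elim (x≢y refl)
∈-─⁺ (here refl) (there x∈ys) _  = x∈ys
∈-─⁺ (there _)   (here refl) _   = here refl
∈-─⁺ (there y∈ys) (there x∈ys) x≢y = there (∈-─⁺ y∈ys x∈ys x≢y)

Unique-⊆⇒length-≤ : {xs ys : List A} → Unique xs → xs ⊆ ys → length xs ≤ length ys
Unique-⊆⇒length-≤ [] _ = z≤n
Unique-⊆⇒length-≤ {xs = x ∷ xs} {ys} (x∉xs ∷ unique) xs⊆ys = begin
  suc (length xs)              ≤⟨ s≤s (Unique-⊆⇒length-≤ unique xs⊆ys─x) ⟩
  suc (length (ys ─ x∈ys))     ≡⟨ sym (length-removeAt′ ys (index x∈ys)) ⟩
  length ys                    ∎
  where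
  open ≤-Reasoning
  x∈ys = xs⊆ys (here refl)
  xs⊆ys─x : xs ⊆ (ys ─ x∈ys)
  xs⊆ys─x z∈xs = ∈-─⁺ x∈ys (xs⊆ys (there z∈xs)) (≢-sym (All.lookup x∉xs z∈xs))

words : ∀ n m → List (Vec (Fin n) m)
words n zero    = [] ∷ []
words n (suc m) = cartesianProductWith _∷_ (allFin n) (words n m)

∈-words : (w : Vec (Fin n) m) → w ∈ words n m
∈-words []      = here refl
∈-words (c ∷ w) = ∈-cartesianProductWith⁺ _∷_ (∈-allFin c) (∈-words w)

words-unique : ∀ n m → Unique (words n m)
words-unique n zero    = [] ∷ []
words-unique n (suc m) =
  cartesianProductWith⁺ _∷_ (λ eq → ∷-injectiveˡ eq , ∷-injectiveʳ eq) (allFin⁺ n) (words-unique n m)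

length-words : ∀ n m → length (words n m) ≡ n ^ m
length-words n zero    = refl
length-words n (suc m) =
  trans (length-cartesianProductWith _∷_ (allFin n) (words n m))
        (cong₂ _*_ (length-tabulate {n = n} id) (length-words n m))

-- w · s is the vertex s of the copy of S² at address w.
_·_ : Vec A m → Vec A 2 → Vec A (suc (suc m))
[]      · s = s
(c ∷ w) · s = c ∷ (w · s)

·-injective : (w w′ : Vec A m) {s s′ : Vec A 2} → w · s ≡ w′ · s′ → w ≡ w′ × s ≡ s′
·-injective []      []        eq = refl , eq
·-injective (c ∷ w) (c′ ∷ w′) eq =
  let w≡w′ , s≡s′ = ·-injective w w′ (∷-injectiveʳ eq)
  in cong₂ _∷_ (∷-injectiveˡ eq) w≡w′ , s≡s′

split-· : (x : Vec A (suc (suc m))) → ∃₂ λ w s → x ≡ w · s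
split-· {m = zero}  x       = [] , x , refl
split-· {m = suc m} (c ∷ x) = let w , s , x≡w·s = split-· x in c ∷ w , s , cong (c ∷_) x≡w·s

last-· : (w : Vec A m) (s : Vec A 2) → last (w · s) ≡ last s
last-· []      s = refl
last-· (c ∷ w) s = last-· w s

·-replicate : (w : Vec A m) {s : Vec A 2} {b : A} → w · s ≡ replicate _ b → s ≡ replicate 2 b
·-replicate []      eq = eq
·-replicate (c ∷ w) eq = ·-replicate w (∷-injectiveʳ eq)

data Edge (G : Graph) : Word G k → Word G k → Set where
  between : ∀ {a b} → a ≢ b → Adj G a b → Edge G (a ∷ replicate k b) (b ∷ replicate k a)
  within  : ∀ {c} {x y : Word G k} → Edge G x y → Edge G (c ∷ x) (c ∷ y)

module _ {G : Graph} where

  pointwise-replicate : (v : Word G k) (b : Fin (order G)) → (∀ j → lookup v j ≡ b) → v ≡ replicate k b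
  pointwise-replicate []      b all-b = refl
  pointwise-replicate (a ∷ v) b all-b = cong₂ _∷_ (all-b zero) (pointwise-replicate v b (λ j → all-b (suc j)))

  SAdj⇒Edge : (x y : Word G k) → SAdj G k x y → Edge G x y
  SAdj⇒Edge (a ∷ x) (b ∷ y) (zero , _ , a≢b , adj , after) =
    subst₂ (λ u v → Edge G (a ∷ u) (b ∷ v))
      (sym (pointwise-replicate x b (λ j → proj₁ (after (suc j) z<s))))
      (sym (pointwise-replicate y a (λ j → proj₂ (after (suc j) z<s))))
      (between a≢b adj)
  SAdj⇒Edge (a ∷ x) (b ∷ y) (suc i , before , a≢b , adj , after) with before zero z<s
  ... | refl = within (SAdj⇒Edge x y (i , (λ j j<i → before (suc j) (s<s j<i)) , a≢b , adj ,
                                          (λ j i<j → after (suc j) (s<s i<j))))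

  Edge⇒SAdj : {x y : Word G k} → Edge G x y → SAdj G k x y
  Edge⇒SAdj (between {a = a} {b} a≢b adj) =
    zero , (λ _ ()) , a≢b , adj , λ { zero () ; (suc j) _ → lookup-replicate j b , lookup-replicate j a }
  Edge⇒SAdj (within e) =
    let i , before , ≢ , adj , after = Edge⇒SAdj e
    in suc i , (λ { zero _ → refl ; (suc j) (s<s j<i) → before j j<i }) , ≢ , adj ,
               (λ { zero () ; (suc j) (s<s i<j) → after j i<j })

  Edge-· : (w : Word G m) {s t : Word G 2} → Edge G s t → Edge G (w · s) (w · t)
  Edge-· []      e = e
  Edge-· (c ∷ w) e = within (Edge-· w e)

  last-replicate : (b : Fin (order G)) → last (replicate (suc k) b) ≡ b
  last-replicate {k = zero}  b = refl
  last-replicate {k = suc k} b = last-replicate {k = k} b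

  Edge-last : {x y : Word G (suc k)} → Edge G x y → Adj G (last x) (last y) ⊎ Adj G (last y) (last x)
  Edge-last {k = zero}  (between _ adj) = inj₁ adj
  Edge-last {k = suc k} (between {a = a} {b} _ adj) =
    inj₂ (subst₂ (Adj G) (sym (last-replicate {k = k} a)) (sym (last-replicate {k = k} b)) adj)
  Edge-last {k = suc k} (within e) = Edge-last e

  -- An edge between copies into w · s would force s to be constant.
  Edge-into-· : (w : Word G m) {s : Word G 2} → (∀ b → s ≢ replicate 2 b) →
    ∀ {a} → Edge G a (w · s) → ∃ λ t → a ≡ w · t × Edge G t s
  Edge-into-· w {s} s-nonconstant e = go w e refl
    where
    go : ∀ {m} (w : Word G m) {a y} → Edge G a y → y ≡ w · s → ∃ λ t → a ≡ w · t × Edge G t s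
    go []      e y≡s = _ , refl , subst (Edge G _) y≡s e
    go (c ∷ w) (between _ _) y≡c∷w·s = ⊥-elim (s-nonconstant _ (·-replicate w (sym (∷-injectiveʳ y≡c∷w·s))))
    go (c ∷ w) (within e) y≡c∷w·s with ∷-injectiveˡ y≡c∷w·s
    ... | refl = let t , a≡w·t , e′ = go w e (∷-injectiveʳ y≡c∷w·s) in t , cong (c ∷_) a≡w·t , e′

module _ (G : Graph) where

  Confines : (Word G 2 → Set) → Word G 2 → Set
  Confines R x = R x × (∀ {t} → Edge G t x → R t)

  record Trap (R : Word G 2 → Set) : Set where
    field
      x y           : Word G 2
      x-nonconstant : ∀ b → x ≢ replicate 2 b
      y-nonconstant : ∀ b → y ≢ replicate 2 b
      edge          : Edge G x y
      x-confined    : Confines R x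
      y-confined    : Confines R y

module _ {G : Graph} {A : List (Word G (suc (suc m)))} (isolating : Isolating G _ A) where

  Isolating-meets-trap : {R : Word G 2 → Set} → Decidable R → Trap G R →
                         (w : Word G m) → ∃ λ t → R t × w · t ∈ A
  -- Isolation only refutes the absence of such a t; a search of the copy finds one.
  Isolating-meets-trap {R} R? trap w with any? (λ t → R? t ×-dec any? (≡-dec Fin._≟_ (w · t)) A) (words _ 2)
  ... | yes found = let t , _ , found-t = find found in t , found-t
  ... | no none =
    ⊥-elim (isolating _ _ (undominated x-nonconstant x-confined) (undominated y-nonconstant y-confined)
                          (Edge⇒SAdj (Edge-· w edge)))
    where
    open Trap trap
    undominated : ∀ {s} → (∀ b → s ≢ replicate 2 b) → Confines G R s → ¬ InClosedNbhd G _ A (w · s)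
    undominated {s} _ (Rs , _) (a , a∈A , inj₁ refl) = none (lose (∈-words s) (Rs , a∈A))
    undominated s-nonconstant (_ , R-nbrs) (a , a∈A , inj₂ a~w·s) =
      let t , a≡w·t , t~s = Edge-into-· {G = G} w s-nonconstant (SAdj⇒Edge a _ a~w·s)
      in none (lose (∈-words t) (R-nbrs t~s , subst (_∈ A) a≡w·t a∈A))

pattern v₀ = zero
pattern v₁ = suc zero
pattern v₂ = suc (suc zero)
pattern v₃ = suc (suc (suc zero))

data Odd : Fin 4 → Set where
  odd₁ : Odd v₁
  odd₃ : Odd v₃

odd-cover : ∀ {a b} → C4Adj a b → Odd a ⊎ Odd b
odd-cover e01 = inj₂ odd₁
odd-cover e10 = inj₁ odd₁
odd-cover e12 = inj₁ odd₁
odd-cover e21 = inj₂ odd₁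
odd-cover e23 = inj₂ odd₃
odd-cover e32 = inj₁ odd₃
odd-cover e30 = inj₁ odd₃
odd-cover e03 = inj₂ odd₃

roots : List (Word C4 2)
roots = (v₀ ∷ v₀ ∷ []) ∷ (v₁ ∷ v₂ ∷ []) ∷ (v₃ ∷ v₂ ∷ []) ∷ []

roots-unique : Unique roots
roots-unique = ((λ ()) ∷ (λ ()) ∷ []) ∷ ((λ ()) ∷ []) ∷ [] ∷ []

roots-dominate-odd : ∀ p {q} → Odd q → ∃ λ r → r ∈ roots × Edge C4 r (p ∷ q ∷ [])
roots-dominate-odd v₀ odd₁ = _ , here refl ,                 within (between (λ ()) e01)
roots-dominate-odd v₁ odd₁ = _ , there (here refl) ,         within (between (λ ()) e21)
roots-dominate-odd v₂ odd₁ = _ , there (here refl) ,         between (λ ()) e12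
roots-dominate-odd v₃ odd₁ = _ , there (there (here refl)) , within (between (λ ()) e21)
roots-dominate-odd v₀ odd₃ = _ , here refl ,                 within (between (λ ()) e03)
roots-dominate-odd v₁ odd₃ = _ , there (here refl) ,         within (between (λ ()) e23)
roots-dominate-odd v₂ odd₃ = _ , there (there (here refl)) , between (λ ()) e32
roots-dominate-odd v₃ odd₃ = _ , there (there (here refl)) , within (between (λ ()) e23)

isolating-set : ∀ m → List (Word C4 (suc (suc m)))
isolating-set m = cartesianProductWith _·_ (words 4 m) roots

isolating-set-unique : ∀ m → Unique (isolating-set m)
isolating-set-unique m = cartesianProductWith⁺ _·_ (·-injective _ _) (words-unique 4 m) roots-unique

length-isolating-set : ∀ m → length (isolating-set m) ≡ 3 * 4 ^ m
length-isolating-set m = begin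
  length (isolating-set m)      ≡⟨ length-cartesianProductWith _·_ (words 4 m) roots ⟩
  length (words 4 m) * 3        ≡⟨ cong (_* 3) (length-words 4 m) ⟩
  4 ^ m * 3                     ≡⟨ *-comm (4 ^ m) 3 ⟩
  3 * 4 ^ m                     ∎
  where open ≡-Reasoning

odd-dominated : (x : Word C4 (suc (suc m))) → Odd (last x) → InClosedNbhd C4 _ (isolating-set m) x
odd-dominated x odd with split-· x
... | w , s@(p ∷ q ∷ []) , refl =
  let r , r∈roots , r~s = roots-dominate-odd p (subst Odd (last-· w s) odd)
  in w · r , ∈-cartesianProductWith⁺ _·_ (∈-words w) r∈roots , inj₂ (Edge⇒SAdj (Edge-· w r~s))

Edge-odd-endpoint : {x y : Word C4 (suc k)} → Edge C4 x y → Odd (last x) ⊎ Odd (last y)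
Edge-odd-endpoint e with Edge-last e
... | inj₁ adj = odd-cover adj
... | inj₂ adj = swap (odd-cover adj)

isolating-set-isolating : ∀ m → Isolating C4 (suc (suc m)) (isolating-set m)
isolating-set-isolating m x y x-free y-free x~y =
  [ (λ odd → x-free (odd-dominated x odd)) , (λ odd → y-free (odd-dominated y odd)) ]′
    (Edge-odd-endpoint (SAdj⇒Edge {G = C4} x y x~y))

-- Block i contains the closed neighbourhoods of both ends of trap i:
-- 01–02 in {00,…,03,10}, 12–21 in {11,…,13,20,21,22}, 31–32 in {23,30,…,33}.
block : Word C4 2 → Fin 3
block (v₀ ∷ _  ∷ []) = zero
block (v₁ ∷ v₀ ∷ []) = zero
block (v₁ ∷ _  ∷ []) = suc zero
block (v₂ ∷ v₃ ∷ []) = suc (suc zero)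
block (v₂ ∷ _  ∷ []) = suc zero
block (v₃ ∷ _  ∷ []) = suc (suc zero)

trap : (i : Fin 3) → Trap C4 (λ t → block t ≡ i)
trap zero = record
  { x = v₀ ∷ v₁ ∷ [] ; y = v₀ ∷ v₂ ∷ [] ; x-nonconstant = λ _ () ; y-nonconstant = λ _ ()
  ; edge = within (between (λ ()) e12)
  ; x-confined = refl , λ
      { (between _ e10) → refl
      ; (within (between _ e01)) → refl
      ; (within (between _ e21)) → refl
      }
  ; y-confined = refl , λ
      { (within (between _ e12)) → refl
      ; (within (between _ e32)) → refl
      }
  }
trap (suc zero) = record
  { x = v₁ ∷ v₂ ∷ [] ; y = v₂ ∷ v₁ ∷ [] ; x-nonconstant = λ _ () ; y-nonconstant = λ _ ()
  ; edge = between (λ ()) e12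
  ; x-confined = refl , λ
      { (between _ e21) → refl
      ; (within (between _ e12)) → refl
      ; (within (between _ e32)) → refl
      }
  ; y-confined = refl , λ
      { (between _ e12) → refl
      ; (within (between _ e01)) → refl
      ; (within (between _ e21)) → refl
      }
  }
trap (suc (suc zero)) = record
  { x = v₃ ∷ v₁ ∷ [] ; y = v₃ ∷ v₂ ∷ [] ; x-nonconstant = λ _ () ; y-nonconstant = λ _ ()
  ; edge = within (between (λ ()) e12)
  ; x-confined = refl , λ
      { (within (between _ e01)) → refl
      ; (within (between _ e21)) → refl
      }
  ; y-confined = refl , λ
      { (between _ e23) → refl
      ; (within (between _ e12)) → refl
      ; (within (between _ e32)) → refl
      }
  }

Isolating⇒length-≥ : (A : List (Word C4 (suc (suc m)))) → Isolating C4 _ A → 3 * 4 ^ m ≤ length A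
Isolating⇒length-≥ {m} A isolating = begin
  3 * 4 ^ m                                          ≡⟨ *-comm 3 (4 ^ m) ⟩
  4 ^ m * 3                                          ≡⟨ cong (_* 3) (length-words 4 m) ⟨
  length (words 4 m) * 3                             ≡⟨ length-cartesianProductWith hit (words 4 m) (allFin 3) ⟨
  length (cartesianProductWith hit (words 4 m) (allFin 3))
                                                     ≤⟨ Unique-⊆⇒length-≤ hits-unique hits⊆A ⟩
  length A                                           ∎
  where
  open ≤-Reasoning
  meets : ∀ w i → ∃ λ t → block t ≡ i × w · t ∈ A
  meets w i = Isolating-meets-trap isolating (λ t → block t Fin.≟ i) (trap i) w
  hit : Word C4 m → Fin 3 → Word C4 (suc (suc m))
  hit w i = w · proj₁ (meets w i)
  block-hit : ∀ w i → block (proj₁ (meets w i)) ≡ i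
  block-hit w i = proj₁ (proj₂ (meets w i))
  hit-injective : ∀ {w w′ i i′} → hit w i ≡ hit w′ i′ → w ≡ w′ × i ≡ i′
  hit-injective {w} {w′} {i} {i′} eq =
    let w≡w′ , t≡t′ = ·-injective w w′ eq
    in w≡w′ , trans (sym (block-hit w i)) (trans (cong block t≡t′) (block-hit w′ i′))
  hits-unique : Unique (cartesianProductWith hit (words 4 m) (allFin 3))
  hits-unique = cartesianProductWith⁺ hit hit-injective (words-unique 4 m) (allFin⁺ 3)
  hits⊆A : cartesianProductWith hit (words 4 m) (allFin 3) ⊆ A
  hits⊆A v∈hits with ∈-cartesianProductWith⁻ hit (words 4 m) (allFin 3) v∈hits
  ... | w , i , _ , _ , refl = proj₂ (proj₂ (meets w i))

corollary5p5 : (n : ℕ) → 2 ≤ n → IsolationNumber C4 n (3 * 4 ^ (n ∸ 2))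
corollary5p5 (suc (suc m)) (s≤s (s≤s _)) =
  (isolating-set m , isolating-set-unique m , isolating-set-isolating m , length-isolating-set m) ,
  λ A _ isolating → Isolating⇒length-≥ A isolating
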